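{- Let $k$ and $n\ge1$ be positive integers with $k\nmid n$. For every $\pi\in S_{n-1}$ and every $x\in\{1,\dots,n\}$, the number of $k$-cycles of $\pi$ equals the number of $k$-cycles of $\phi_k(\pi,x)\in S_n$.
   Context: A $k$-cycle is a cycle of length exactly $k$. For a finite set $A$ of positive integers, a permutation $\sigma$ of $A$ is written in canonical cycle notation $\sigma=c^{(t)}\cdots c^{(1)}$, where each cycle $c^{(i)}=(c^{(i)}_1\cdots c^{(i)}_{\ell_i})$ starts with its largest element and $c^{(t)}_1<\cdots<c^{(1)}_1$ (so $c^{(1)}$, the rightmost cycle, contains the largest element of $A$); the empty permutation $\emptyset$ has $t=0$. Mutually recursive maps are defined: $\phi_k$ takes $(\sigma,x)$ with $\sigma$ a permutation of $A$ and $x\notin A$ and returns a permutation of $A\cup\{x\}$; $\psi_k$ takes a permutation of a nonempty set $B$ and returns a pair $(\sigma,y)$ with $y\in B$ and $\sigma$ a permutation of $B\setminus\{y\}$. Inputs are always written in canonical cycle notation, writing $c_j=c^{(1)}_j$, $\ell_1$ for the length of $c^{(1)}$, and $(\pi',x')=\psi_k(c^{(t)}\cdots c^{(2)})$ where used; the first applicable case is used. Define $\phi_k(\emptyset,x)=(x)$, and for nonempty $\sigma$: (a) if $x>c_1$: $\phi_k(\sigma,x)=c^{(t)}\cdots c^{(1)}(x)$; (b) if $\ell_1=k$: $\phi_k(\sigma,x)=\phi_k(c^{(t)}\cdots c^{(2)},c_2)\,(c_1c_3\cdots c_kx)$; (c) if $\ell_1=k-1$ and $t>1$: $\phi_k(\sigma,x)=\pi'(c_1x'c_2\cdots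 c_{k-1}x)$; (d) otherwise $\phi_k(\sigma,x)=c^{(t)}\cdots c^{(2)}(c_1\cdots c_{\ell_1}x)$. For nonempty $\sigma$: (a) if $\ell_1=1$: $\psi_k(\sigma)=(c^{(t)}\cdots c^{(2)},c_1)$; (b) if $\ell_1=k+1$: $\psi_k(\sigma)=(\phi_k(c^{(t)}\cdots c^{(2)},c_2)(c_1c_3\cdots c_k),\,c_{k+1})$; (c) if $\ell_1=k$ and $t>1$: $\psi_k(\sigma)=(\pi'(c_1x'c_2\cdots c_{k-1}),\,c_k)$; (d) otherwise $\psi_k(\sigma)=(c^{(t)}\cdots c^{(2)}(c_1\cdots c_{\ell_1-1}),\,c_{\ell_1})$. For $\pi\in S_{n-1}$ and $x\in\{1,\dots,n\}$, $\phi_k(\pi,x)\in S_n$ is obtained by replacing every letter $j\ge x$ of $\pi$ by $j+1$ and then applying $\phi_k$ above with inserted letter $x$. -}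

module Defs where

open import Data.Nat using (ℕ; zero; suc; _+_; _∸_; _≤_; _<_; _≤ᵇ_; _<ᵇ_; _≡ᵇ_)
open import Data.Bool using (Bool; true; false; if_then_else_; _∧_)
open import Data.List using (List; []; _∷_; _++_; [_]; length; map; concat; upTo; filter)
open import Data.List.Relation.Unary.All using (All)
open import Data.List.Relation.Unary.Linked using (Linked)
open import Data.List.Relation.Binary.Permutation.Propositional using (_↭_)
open import Data.Product using (_×_; _,_; proj₁; proj₂)
open import Data.Empty using (⊥)
open import Data.Nat using (_≟_)

-- A permutation in canonical cycle notation  σ = c^(t) ⋯ c^(2) c^(1)
-- is stored as the list  c^(1) ∷ c^(2) ∷ ⋯ ∷ c^(t) ∷ []
-- (i.e. the cycles in REVERSE order of the written notation, so that the
-- rightmost cycle c^(1), containing the largest element, is the head).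
Cycle : Set
Cycle = List ℕ

Perm : Set
Perm = List Cycle

unsnoc' : List ℕ → List ℕ × ℕ
unsnoc' []           = [] , 0
unsnoc' (a ∷ [])     = [] , a
unsnoc' (a ∷ b ∷ as) = a ∷ proj₁ (unsnoc' (b ∷ as)) , proj₂ (unsnoc' (b ∷ as))

isNil : Perm → Bool
isNil []      = true
isNil (_ ∷ _) = false

mutual
  φ : ℕ → Perm → ℕ → Perm
  φ k [] x = [ x ] ∷ []
  φ k ([] ∷ rest) x = [] ∷ rest            -- ill-formed input (empty cycle); never occurs
  φ k ((c₁ ∷ cs) ∷ rest) x =
    if c₁ <ᵇ x then [ x ] ∷ (c₁ ∷ cs) ∷ rest                              -- (a)
    else φb k c₁ cs rest x

  φb : ℕ → ℕ → List ℕ → Perm → ℕ → Perm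
  φb k c₁ (c₂ ∷ cs') rest x =
    if length (c₁ ∷ c₂ ∷ cs') ≡ᵇ k
    then (c₁ ∷ cs' ++ [ x ]) ∷ φ k rest c₂                                -- (b)
    else φc k c₁ (c₂ ∷ cs') rest x
  φb k c₁ [] rest x = φc k c₁ [] rest x

  φc : ℕ → ℕ → List ℕ → Perm → ℕ → Perm
  φc k c₁ cs rest x =
    if (length (c₁ ∷ cs) + 1 ≡ᵇ k) ∧ (if isNil rest then false else true)
    then (c₁ ∷ proj₂ (ψ k rest) ∷ cs ++ [ x ]) ∷ proj₁ (ψ k rest)          -- (c)
    else ((c₁ ∷ cs) ++ [ x ]) ∷ rest                                       -- (d)

  ψ : ℕ → Perm → Perm × ℕ
  ψ k [] = [] , 0                                 -- not used (input nonempty)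
  ψ k ([] ∷ rest) = rest , 0                      -- ill-formed input; never occurs
  ψ k ((c₁ ∷ []) ∷ rest) = rest , c₁                                       -- (a)
  ψ k ((c₁ ∷ c₂ ∷ d) ∷ rest) =
    if length (c₁ ∷ c₂ ∷ d) ≡ᵇ k + 1
    then ((c₁ ∷ proj₁ (unsnoc' d)) ∷ φ k rest c₂ , proj₂ (unsnoc' d))       -- (b)
    else ψc k c₁ (c₂ ∷ d) rest

  ψc : ℕ → ℕ → List ℕ → Perm → Perm × ℕ
  ψc k c₁ cs rest =
    if (length (c₁ ∷ cs) ≡ᵇ k) ∧ (if isNil rest then false else true)
    then ((c₁ ∷ proj₂ (ψ k rest) ∷ proj₁ (unsnoc' cs)) ∷ proj₁ (ψ k rest)
         , proj₂ (unsnoc' cs))                                             -- (c)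
    else ((c₁ ∷ proj₁ (unsnoc' cs)) ∷ rest , proj₂ (unsnoc' cs))           -- (d)

-- φ_k(π , x) for π ∈ S_{n-1}, x ∈ {1..n}: shift letters j ≥ x to j+1, then insert x.
shift : ℕ → ℕ → ℕ
shift x j = if x ≤ᵇ j then suc j else j

φIns : ℕ → Perm → ℕ → Perm
φIns k π x = φ k (map (map (shift x)) π) x

HeadMax : Cycle → Set
HeadMax []       = ⊥
HeadMax (a ∷ as) = All (λ b → b < a) as

HeadGt : Cycle → Cycle → Set
HeadGt (a ∷ _) (b ∷ _) = b < a
HeadGt _ _ = ⊥

IsPermOf : ℕ → Perm → Set
IsPermOf m σ = All HeadMax σ × Linked HeadGt σ × (concat σ ↭ map suc (upTo m))

numCycles : ℕ → Perm → ℕ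
numCycles k σ = length (filter (λ c → length c ≟ k) σ)

{-# OPTIONS --safe #-}
-- Both φ_k and ψ_k only edit the first cycle c⁽¹⁾ and recurse, possibly through
-- each other, on the remaining cycles.  The length of c⁽¹⁾ either stays k
-- (φ (b), ψ (c)) or moves between two values both different from k
-- (k − 1 ↔ k + 1 in φ (c), ψ (b); ℓ ↔ ℓ ± 1 in case (d)), so the number of
-- k-cycles is preserved whenever the recursive call preserves it.  Case (d)
-- could only create or destroy a k-cycle when σ is a single cycle and |σ| + 1
-- (for φ) or |σ| (for ψ) equals k; the hypothesis k ∤ |σ| + 1, resp. k ∤ |σ|,
-- excludes this, and it is inherited by the recursive calls because the first
-- cycle accounts for exactly k of the letters involved.
module Submission where

open import Defs
open import Data.Nat using (ℕ; _≤_; _∸_)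
open import Data.Nat.Divisibility using (_∣_)
open import Relation.Nullary using (¬_)
open import Relation.Binary.PropositionalEquality using (_≡_)

open import Data.Bool using (true; false; T; if_then_else_; _∧_)
open import Data.Bool.Properties using (∧-zeroʳ; ∧-identityʳ; not-¬)
open import Data.Empty using (⊥-elim)
open import Data.List using (List; []; _∷_; _++_; [_]; length; map; concat; upTo)
open import Data.List.Properties using (length-++; length-map; length-upTo; filter-accept; filter-reject)
open import Data.List.Relation.Binary.Permutation.Propositional.Properties using (↭-length)
open import Data.Nat using (zero; suc; _+_; _<_; s≤s; z≤n; z<s; _≡ᵇ_; _<ᵇ_; _≟_)
open import Data.Nat.Divisibility using (∣m∣n⇒∣m+n; ∣-refl; 1∣_)
open import Data.Nat.ListAction using (sum)
open import Data.Nat.Properties using (≡ᵇ⇒≡; ≡⇒≡ᵇ; +-suc; +-comm; +-identityʳ; suc-injective; 1+n≢n; <⇒≢; <-trans)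
open import Data.Product using (_,_; proj₁; proj₂)
open import Function using (_∘_; id)
open import Relation.Nullary using (yes; no)
open import Relation.Binary.PropositionalEquality using (_≢_; refl; sym; trans; cong; cong₂; subst; module ≡-Reasoning)

≡ᵇ-true⇒≡ : ∀ {m n} → (m ≡ᵇ n) ≡ true → m ≡ n
≡ᵇ-true⇒≡ {m} {n} eq = ≡ᵇ⇒≡ m n (subst T (sym eq) _)

≡ᵇ-false⇒≢ : ∀ {m n} → (m ≡ᵇ n) ≡ false → m ≢ n
≡ᵇ-false⇒≢ {m} {n} eq m≡n = subst T eq (≡⇒≡ᵇ m n m≡n)

∧-true : ∀ {a b} → a ∧ true ≡ b → a ≡ b
∧-true {a} = trans (sym (∧-identityʳ a))

m≡n⇒1+m≢n : ∀ {m n} → m ≡ n → suc m ≢ n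
m≡n⇒1+m≢n refl = 1+n≢n

∤⇒≢ : ∀ {k m} → ¬ k ∣ m → m ≢ k
∤⇒≢ k∤m refl = k∤m ∣-refl

∤-drop : ∀ {k m n} → m ≡ k → ¬ k ∣ m + n → ¬ k ∣ n
∤-drop refl k∤k+n k∣n = k∤k+n (∣m∣n⇒∣m+n ∣-refl k∣n)

∤-drop-suc : ∀ {k m n} → m ≡ k → ¬ k ∣ suc (m + n) → ¬ k ∣ suc n
∤-drop-suc {k} {m} {n} m≡k k∤ = ∤-drop m≡k (k∤ ∘ subst (k ∣_) (+-suc m n))

length-∷ʳ : ∀ {A : Set} (xs : List A) x → length (xs ++ [ x ]) ≡ suc (length xs)
length-∷ʳ []       x = refl
length-∷ʳ (_ ∷ xs) x = cong suc (length-∷ʳ xs x)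

length-unsnoc' : ∀ a as → suc (length (proj₁ (unsnoc' (a ∷ as)))) ≡ length (a ∷ as)
length-unsnoc' a []       = refl
length-unsnoc' a (b ∷ bs) = cong suc (length-unsnoc' b bs)

length-init-≢ : ∀ {k} c₁ c₂ d → length (c₁ ∷ c₂ ∷ d) ≢ k + 1 → length (c₁ ∷ proj₁ (unsnoc' (c₂ ∷ d))) ≢ k
length-init-≢ {k} c₁ c₂ d ℓ≢k+1 ℓ-1≡k =
  ℓ≢k+1 (trans (cong suc (trans (sym (length-unsnoc' c₂ d)) ℓ-1≡k)) (+-comm 1 k))

size : Perm → ℕ
size σ = sum (map length σ)

length-concat : ∀ σ → length (concat σ) ≡ size σ
length-concat []      = refl
length-concat (c ∷ σ) = trans (length-++ c) (cong (length c +_) (length-concat σ))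

size-map-map : ∀ (f : ℕ → ℕ) σ → size (map (map f) σ) ≡ size σ
size-map-map f []      = refl
size-map-map f (c ∷ σ) = cong₂ _+_ (length-map f c) (size-map-map f σ)

size-IsPermOf : ∀ {m σ} → IsPermOf m σ → size σ ≡ m
size-IsPermOf {m} {σ} (_ , _ , σ↭) = begin
  size σ                    ≡⟨ sym (length-concat σ) ⟩
  length (concat σ)         ≡⟨ ↭-length σ↭ ⟩
  length (map suc (upTo m)) ≡⟨ length-map suc (upTo m) ⟩
  length (upTo m)           ≡⟨ length-upTo m ⟩
  m                         ∎
  where open ≡-Reasoning

module NumCycles (k : ℕ) where

  numCycles-∷-≡ : ∀ c σ → length c ≡ k → numCycles k (c ∷ σ) ≡ suc (numCycles k σ)
  numCycles-∷-≡ c σ ℓ≡k = cong length (filter-accept (λ c → length c ≟ k) {c} {σ} ℓ≡k)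

  numCycles-∷-≢ : ∀ c σ → length c ≢ k → numCycles k (c ∷ σ) ≡ numCycles k σ
  numCycles-∷-≢ c σ ℓ≢k = cong length (filter-reject (λ c → length c ≟ k) {c} {σ} ℓ≢k)

  numCycles-∷-cong : ∀ c d {σ τ} → length c ≡ length d →
                     numCycles k σ ≡ numCycles k τ → numCycles k (c ∷ σ) ≡ numCycles k (d ∷ τ)
  numCycles-∷-cong c d {σ} {τ} c≡d σ≈τ with length d ≟ k
  ... | yes d≡k = trans (numCycles-∷-≡ c σ (trans c≡d d≡k)) (trans (cong suc σ≈τ) (sym (numCycles-∷-≡ d τ d≡k)))
  ... | no  d≢k = trans (numCycles-∷-≢ c σ (d≢k ∘ trans (sym c≡d))) (trans σ≈τ (sym (numCycles-∷-≢ d τ d≢k)))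

  numCycles-∷-cong-≢ : ∀ c d {σ τ} → length c ≢ k → length d ≢ k →
                       numCycles k σ ≡ numCycles k τ → numCycles k (c ∷ σ) ≡ numCycles k (d ∷ τ)
  numCycles-∷-cong-≢ c d {σ} {τ} c≢k d≢k σ≈τ =
    trans (numCycles-∷-≢ c σ c≢k) (trans σ≈τ (sym (numCycles-∷-≢ d τ d≢k)))

  -- Splits on the condition of an if without with-abstraction, which would also
  -- rewrite the unfolded count on the right-hand side.
  numCycles-if : ∀ {A : Set} (f : A → Perm) b {x y n} →
                 (b ≡ true → numCycles k (f x) ≡ n) → (b ≡ false → numCycles k (f y) ≡ n) →
                 numCycles k (f (if b then x else y)) ≡ n
  numCycles-if f true  then-case _ = then-case refl
  numCycles-if f false _ else-case = else-case refl

  numCycles-map-map : ∀ (f : ℕ → ℕ) σ → numCycles k (map (map f) σ) ≡ numCycles k σ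
  numCycles-map-map f []      = refl
  numCycles-map-map f (c ∷ σ) = numCycles-∷-cong (map f c) c (length-map f c) (numCycles-map-map f σ)

module _ {k : ℕ} (1<k : 1 < k) where

  open NumCycles k

  private
    1≢k : 1 ≢ k
    1≢k = <⇒≢ 1<k

    0≢k : 0 ≢ k
    0≢k = <⇒≢ (<-trans z<s 1<k)

  mutual
    φ-numCycles : ∀ σ x → ¬ k ∣ suc (size σ) → numCycles k (φ k σ x) ≡ numCycles k σ
    φ-numCycles []              x _  = numCycles-∷-≢ [ x ] [] 1≢k
    φ-numCycles ([] ∷ σ)        x _  = refl
    φ-numCycles ((c₁ ∷ cs) ∷ σ) x k∤ = numCycles-if id (c₁ <ᵇ x)
      (λ _ → numCycles-∷-≢ [ x ] ((c₁ ∷ cs) ∷ σ) 1≢k)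
      (λ _ → φb-numCycles c₁ cs σ x k∤)

    φb-numCycles : ∀ c₁ cs σ x → ¬ k ∣ suc (size ((c₁ ∷ cs) ∷ σ)) →
                   numCycles k (φb k c₁ cs σ x) ≡ numCycles k ((c₁ ∷ cs) ∷ σ)
    φb-numCycles c₁ []        σ x k∤ = φc-numCycles c₁ [] σ x 1≢k k∤
    φb-numCycles c₁ (c₂ ∷ cs) σ x k∤ = numCycles-if id (length (c₁ ∷ c₂ ∷ cs) ≡ᵇ k)
      (λ ℓ≡ᵇk → numCycles-∷-cong (c₁ ∷ cs ++ [ x ]) (c₁ ∷ c₂ ∷ cs) (cong suc (length-∷ʳ cs x))
                  (φ-numCycles σ c₂ (∤-drop-suc (≡ᵇ-true⇒≡ ℓ≡ᵇk) k∤)))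
      (λ ℓ≢ᵇk → φc-numCycles c₁ (c₂ ∷ cs) σ x (≡ᵇ-false⇒≢ ℓ≢ᵇk) k∤)

    φc-numCycles : ∀ c₁ cs σ x → length (c₁ ∷ cs) ≢ k → ¬ k ∣ suc (size ((c₁ ∷ cs) ∷ σ)) →
                   numCycles k (φc k c₁ cs σ x) ≡ numCycles k ((c₁ ∷ cs) ∷ σ)
    φc-numCycles c₁ cs [] x ℓ≢k k∤ = numCycles-if id ((length (c₁ ∷ cs) + 1 ≡ᵇ k) ∧ false)
      (⊥-elim ∘ not-¬ (∧-zeroʳ _))
      (λ _ → numCycles-∷-cong-≢ ((c₁ ∷ cs) ++ [ x ]) (c₁ ∷ cs) ℓ+1≢k ℓ≢k refl)
      where
        ℓ+1≢k : length ((c₁ ∷ cs) ++ [ x ]) ≢ k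
        ℓ+1≢k = ∤⇒≢ k∤ ∘ trans (cong suc (+-identityʳ _)) ∘ trans (sym (length-∷ʳ (c₁ ∷ cs) x))
    φc-numCycles c₁ cs (r ∷ σ) x ℓ≢k k∤ = numCycles-if id ((length (c₁ ∷ cs) + 1 ≡ᵇ k) ∧ true)
      (λ ℓ+1≡ᵇk → let ℓ+1≡k = trans (+-comm 1 (length (c₁ ∷ cs))) (≡ᵇ-true⇒≡ (∧-true ℓ+1≡ᵇk)) in
        numCycles-∷-cong-≢ (c₁ ∷ proj₂ (ψ k (r ∷ σ)) ∷ cs ++ [ x ]) (c₁ ∷ cs)
          (m≡n⇒1+m≢n (trans (cong suc (length-∷ʳ cs x)) ℓ+1≡k)) ℓ≢k
          (ψ-numCycles (r ∷ σ) (∤-drop ℓ+1≡k k∤)))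
      (λ ℓ+1≢ᵇk → numCycles-∷-cong-≢ ((c₁ ∷ cs) ++ [ x ]) (c₁ ∷ cs)
                    (≡ᵇ-false⇒≢ (∧-true ℓ+1≢ᵇk) ∘ trans (sym (length-++ (c₁ ∷ cs)))) ℓ≢k refl)

    ψ-numCycles : ∀ σ → ¬ k ∣ size σ → numCycles k (proj₁ (ψ k σ)) ≡ numCycles k σ
    ψ-numCycles []                  _  = refl
    ψ-numCycles ([] ∷ σ)            _  = sym (numCycles-∷-≢ [] σ 0≢k)
    ψ-numCycles ((c₁ ∷ []) ∷ σ)     _  = sym (numCycles-∷-≢ [ c₁ ] σ 1≢k)
    ψ-numCycles ((c₁ ∷ c₂ ∷ d) ∷ σ) k∤ = numCycles-if proj₁ (length (c₁ ∷ c₂ ∷ d) ≡ᵇ k + 1)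
      (λ ℓ≡ᵇk+1 → ψb-numCycles c₁ c₂ d σ (≡ᵇ-true⇒≡ ℓ≡ᵇk+1) k∤)
      (λ ℓ≢ᵇk+1 → ψc-numCycles c₁ c₂ d σ (≡ᵇ-false⇒≢ ℓ≢ᵇk+1) k∤)

    ψb-numCycles : ∀ c₁ c₂ d σ → length (c₁ ∷ c₂ ∷ d) ≡ k + 1 → ¬ k ∣ size ((c₁ ∷ c₂ ∷ d) ∷ σ) →
                   numCycles k ((c₁ ∷ proj₁ (unsnoc' d)) ∷ φ k σ c₂) ≡ numCycles k ((c₁ ∷ c₂ ∷ d) ∷ σ)
    ψb-numCycles c₁ c₂ []       σ 2≡k+1 _  = ⊥-elim (1≢k (suc-injective (trans 2≡k+1 (+-comm k 1))))
    ψb-numCycles c₁ c₂ (a ∷ as) σ ℓ≡k+1 k∤ =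
      numCycles-∷-cong-≢ (c₁ ∷ proj₁ (unsnoc' (a ∷ as))) (c₁ ∷ c₂ ∷ a ∷ as) ℓ-2≢k ℓ≢k
        (φ-numCycles σ c₂ (∤-drop-suc ℓ-1≡k k∤))
      where
        ℓ-1≡k : length (c₂ ∷ a ∷ as) ≡ k
        ℓ-1≡k = suc-injective (trans ℓ≡k+1 (+-comm k 1))
        ℓ-2≢k : length (c₁ ∷ proj₁ (unsnoc' (a ∷ as))) ≢ k
        ℓ-2≢k ℓ-2≡k = m≡n⇒1+m≢n (trans (sym (length-unsnoc' a as)) ℓ-2≡k) ℓ-1≡k
        ℓ≢k : length (c₁ ∷ c₂ ∷ a ∷ as) ≢ k
        ℓ≢k = m≡n⇒1+m≢n ℓ-1≡k

    ψc-numCycles : ∀ c₁ c₂ d σ → length (c₁ ∷ c₂ ∷ d) ≢ k + 1 → ¬ k ∣ size ((c₁ ∷ c₂ ∷ d) ∷ σ) →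
                   numCycles k (proj₁ (ψc k c₁ (c₂ ∷ d) σ)) ≡ numCycles k ((c₁ ∷ c₂ ∷ d) ∷ σ)
    ψc-numCycles c₁ c₂ d [] ℓ≢k+1 k∤ = numCycles-if proj₁ ((length (c₁ ∷ c₂ ∷ d) ≡ᵇ k) ∧ false)
      (⊥-elim ∘ not-¬ (∧-zeroʳ _))
      (λ _ → numCycles-∷-cong-≢ _ (c₁ ∷ c₂ ∷ d) (length-init-≢ c₁ c₂ d ℓ≢k+1) ℓ≢k refl)
      where
        ℓ≢k : length (c₁ ∷ c₂ ∷ d) ≢ k
        ℓ≢k = ∤⇒≢ k∤ ∘ trans (+-identityʳ _)
    ψc-numCycles c₁ c₂ d (r ∷ σ) ℓ≢k+1 k∤ = numCycles-if proj₁ ((length (c₁ ∷ c₂ ∷ d) ≡ᵇ k) ∧ true)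
      (λ ℓ≡ᵇk → numCycles-∷-cong (c₁ ∷ proj₂ (ψ k (r ∷ σ)) ∷ proj₁ (unsnoc' (c₂ ∷ d))) (c₁ ∷ c₂ ∷ d)
                  (cong suc (length-unsnoc' c₂ d)) (ψ-numCycles (r ∷ σ) (∤-drop (≡ᵇ-true⇒≡ (∧-true ℓ≡ᵇk)) k∤)))
      (λ ℓ≢ᵇk → numCycles-∷-cong-≢ _ (c₁ ∷ c₂ ∷ d) (length-init-≢ c₁ c₂ d ℓ≢k+1) (≡ᵇ-false⇒≢ (∧-true ℓ≢ᵇk)) refl)

theorem4p4 : (k n : ℕ) → 1 ≤ k → 1 ≤ n → ¬ (k ∣ n) →
    (π : Perm) → IsPermOf (n ∸ 1) π →
    (x : ℕ) → 1 ≤ x → x ≤ n →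
    numCycles k π ≡ numCycles k (φIns k π x)
theorem4p4 zero              _       ()  _  _   _ _    _ _ _
theorem4p4 (suc zero)        n       _   _  1∤n _ _    _ _ _ = ⊥-elim (1∤n (1∣ n))
theorem4p4 (suc (suc _))     zero    _   () _   _ _    _ _ _
theorem4p4 k@(suc (suc _))   (suc n) _   _  k∤n π π∈Sₙ x _ _ =
  sym (trans (φ-numCycles (s≤s (s≤s z≤n)) (map (map (shift x)) π) x k∤)
             (NumCycles.numCycles-map-map k (shift x) π))
  where
    k∤ : ¬ k ∣ suc (size (map (map (shift x)) π))
    k∤ rewrite size-map-map (shift x) π | size-IsPermOf π∈Sₙ = k∤n
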